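{- Let $G$ be a graph with no isolated vertex and let $F$ be a $4$-subdivision of $G$. Then $\gamma_t^d(F)\le \gamma_t^d(G)+2$.
   Context: For a graph $G$ with no isolated vertex, a set $S\subseteq V(G)$ is a disjunctive total dominating set if every vertex $v$ of $G$ either has a neighbor in $S$ or has at least two vertices of $S$ at distance exactly $2$ from $v$; $\gamma_t^d(G)$ is the minimum size of such a set. A $4$-subdivision of $G$ is a graph obtained from $G$ by subdividing a single edge of $G$ four times (replacing an edge $uv$ by a path $uw_1w_2w_3w_4v$ with new vertices $w_1,\dots,w_4$). -}

module Defs where

open import Data.Nat using (ℕ; _+_; _≤_)
open import Data.Fin using (Fin; zero; suc; splitAt; _≟_)
open import Data.Fin.Subset using (Subset; _∈_; ∣_∣)
open import Data.Bool using (Bool; true; false; _∧_; _∨_)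
open import Data.Sum using (_⊎_; inj₁; inj₂)
open import Data.Product using (Σ; ∃; ∃-syntax; _×_)
open import Relation.Nullary using (¬_)
open import Relation.Nullary.Decidable using (⌊_⌋)
open import Relation.Binary.PropositionalEquality using (_≡_; _≢_)

record Graph (n : ℕ) : Set where
  field
    Adj   : Fin n → Fin n → Bool
    sym   : ∀ u v → Adj u v ≡ Adj v u
    irrefl : ∀ v → Adj v v ≡ false
open Graph public

_~[_]_ : ∀ {n} → Fin n → Graph n → Fin n → Set
u ~[ G ] v = Adj G u v ≡ true

NoIsolated : ∀ {n} → Graph n → Set
NoIsolated {n} G = ∀ (v : Fin n) → ∃[ w ] (v ~[ G ] w)

Dist2 : ∀ {n} → Graph n → Fin n → Fin n → Set
Dist2 G u v = u ≢ v × ¬ (u ~[ G ] v) × ∃[ w ] (u ~[ G ] w × w ~[ G ] v)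

IsDTD : ∀ {n} → Graph n → Subset n → Set
IsDTD {n} G S = ∀ (v : Fin n) →
  (∃[ s ] (s ∈ S × v ~[ G ] s))
  ⊎ (∃[ s₁ ] ∃[ s₂ ] (s₁ ≢ s₂ × s₁ ∈ S × s₂ ∈ S × Dist2 G v s₁ × Dist2 G v s₂))

IsGammaTD : ∀ {n} → Graph n → ℕ → Set
IsGammaTD {n} G k =
  (∃[ S ] (IsDTD G S × ∣ S ∣ ≡ k)) × (∀ (S : Subset n) → IsDTD G S → k ≤ ∣ S ∣)

-- Vertices of the new graph are
-- Fin (n + 4): the first n are the old vertices, the last 4 are w₁..w₄
-- (indices 0..3 in Fin 4), with path u w₁ w₂ w₃ w₄ v replacing uv.
eqB : ∀ {m} → Fin m → Fin m → Bool
eqB a b = ⌊ a ≟ b ⌋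

pathAdj : Fin 4 → Fin 4 → Bool
pathAdj zero (suc zero) = true
pathAdj (suc zero) zero = true
pathAdj (suc zero) (suc (suc zero)) = true
pathAdj (suc (suc zero)) (suc zero) = true
pathAdj (suc (suc zero)) (suc (suc (suc zero))) = true
pathAdj (suc (suc (suc zero))) (suc (suc zero)) = true
pathAdj _ _ = false

attach : ∀ {n} → Fin n → Fin n → Fin n → Fin 4 → Bool
attach u v a i = (eqB a u ∧ eqB i zero) ∨ (eqB a v ∧ eqB i (suc (suc (suc zero))))

isEdgeUV : ∀ {n} → Fin n → Fin n → Fin n → Fin n → Bool
isEdgeUV u v a b = (eqB a u ∧ eqB b v) ∨ (eqB a v ∧ eqB b u)

notB : Bool → Bool
notB true = false
notB false = true

subAdj⊎ : ∀ {n} → Graph n → Fin n → Fin n → Fin n ⊎ Fin 4 → Fin n ⊎ Fin 4 → Bool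
subAdj⊎ G u v (inj₁ a) (inj₁ b) = Adj G a b ∧ notB (isEdgeUV u v a b)
subAdj⊎ G u v (inj₁ a) (inj₂ i) = attach u v a i
subAdj⊎ G u v (inj₂ i) (inj₁ a) = attach u v a i
subAdj⊎ G u v (inj₂ i) (inj₂ j) = pathAdj i j

SubdivAdj : ∀ {n} → Graph n → Fin n → Fin n → Fin (n + 4) → Fin (n + 4) → Bool
SubdivAdj {n} G u v x y = subAdj⊎ G u v (splitAt n x) (splitAt n y)

-- F is the graph on Fin (n + 4) whose adjacency is SubdivAdj G u v, i.e. the
-- 4-subdivision of G at the edge uv (stated as an equality of adjacency
-- functions so that no symmetry/irreflexivity proofs are needed here).
Is4SubdivisionAt : ∀ {n} → Graph n → Fin n → Fin n → Graph (n + 4) → Set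
Is4SubdivisionAt G u v F = ∀ x y → Adj F x y ≡ SubdivAdj G u v x y

-- Any disjunctive total dominating set S of G becomes one of F after adding two of the
-- new vertices, where the path u w₁ w₂ w₃ w₄ v replaces the edge uv. A vertex x ≠ u, v
-- keeps its neighbours, and a vertex at distance 2 from x stays so unless it was reached
-- through the edge uv; then u, v, w₁ or w₄ takes its place. The endpoints may lose
-- witnesses as well, and a case analysis on which of u, v lie in S and on how many
-- witnesses of u (or v) were reached through v (or u) picks the two path vertices. The
-- path reads the same from v to u, so every fact about u has a mirror image about v and
-- only half of the cases need a proof.
module Submission where

open import Defs hiding (sym)
open import Data.Nat using (ℕ; suc; _+_; _≤_; z≤n; s≤s)
open import Data.Fin using (Fin; _↑ˡ_; _↑ʳ_; splitAt; join; _≟_)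

open import Data.Nat.Properties
  using (≤-trans; ≤-reflexive; +-suc; +-monoʳ-≤; +-mono-≤; +-identityʳ; module ≤-Reasoning)
open import Data.Fin.Patterns using (0F; 1F; 2F; 3F)
open import Data.Fin.Properties using (↑ˡ-injective; splitAt-join; join-splitAt)
open import Data.Fin.Subset using (Subset; _∈_; ∣_∣; _∪_; ⁅_⁆; ⊥; inside; outside)
open import Data.Fin.Subset.Properties
  using (_∈?_; x∈p∪q⁺; x∈⁅x⁆; ∣⁅x⁆∣≡1; ∣⊥∣≡0; ∣p∣≤∣x∷p∣)
open import Data.Vec using ([]; _∷_; _++_; here; there)
open import Data.Bool using (true; false; _∧_; _∨_)
open import Data.Bool.Properties using (∧-identityʳ; ∧-zeroʳ; ∨-identityʳ; ∧-conicalˡ; not-¬)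
open import Data.Sum using (_⊎_; inj₁; inj₂)
open import Data.Product using (∃-syntax; ∃₂; _×_; _,_; proj₁; proj₂)
open import Data.Empty using (⊥-elim)
open import Function using (_∘_; case_of_)
open import Relation.Nullary using (¬_; yes; no)
open import Relation.Nullary.Decidable using (_×-dec_)
open import Relation.Binary.PropositionalEquality
  using (_≡_; _≢_; refl; sym; trans; cong; cong₂; subst)

module _ {m} (H : Graph m) where

  ~-sym : ∀ {x y} → x ~[ H ] y → y ~[ H ] x
  ~-sym {x} {y} x~y = trans (Graph.sym H y x) x~y

  ~⇒≢ : ∀ {x y} → x ~[ H ] y → x ≢ y
  ~⇒≢ {x} x~x refl with trans (sym x~x) (irrefl H x)
  ... | ()

  dist2-sym : ∀ {x y} → Dist2 H x y → Dist2 H y x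
  dist2-sym (x≢y , x≁y , c , x~c , c~y) = x≢y ∘ sym , x≁y ∘ ~-sym , c , ~-sym c~y , ~-sym x~c

-- IsDTD H T is definitionally ∀ x → Dominated H T x.
Dominated : ∀ {m} → Graph m → Subset m → Fin m → Set
Dominated H T x = (∃[ s ] (s ∈ T × x ~[ H ] s))
  ⊎ (∃[ s₁ ] ∃[ s₂ ] (s₁ ≢ s₂ × s₁ ∈ T × s₂ ∈ T × Dist2 H x s₁ × Dist2 H x s₂))

module Domination {m} (H : Graph m) {T : Subset m} {x : Fin m} where

  by-neighbour : ∀ {s} → s ∈ T → x ~[ H ] s → Dominated H T x
  by-neighbour s∈T x~s = inj₁ (_ , s∈T , x~s)

  by-pair : ∀ {s₁ s₂} → s₁ ≢ s₂ → s₁ ∈ T → s₂ ∈ T →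
            Dist2 H x s₁ → Dist2 H x s₂ → Dominated H T x
  by-pair s₁≢s₂ s₁∈T s₂∈T d₁ d₂ = inj₂ (_ , _ , s₁≢s₂ , s₁∈T , s₂∈T , d₁ , d₂)

∈∧∉⇒≢ : ∀ {n} {p : Subset n} {a b} → a ∈ p → ¬ (b ∈ p) → a ≢ b
∈∧∉⇒≢ a∈p b∉p refl = b∉p a∈p

record Subdivision {n m} (G : Graph n) (F : Graph m) : Set₁ where
  field
    u v           : Fin n
    u~v           : u ~[ G ] v
    old           : Fin n → Fin m
    w₁ w₂ w₃ w₄   : Fin m
    old-injective : ∀ {a b} → old a ≡ old b → a ≡ b
    old-adj       : ∀ {a b} → a ~[ G ] b → ¬ (a ≡ u × b ≡ v) → ¬ (a ≡ v × b ≡ u) →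
                    old a ~[ F ] old b
    old-adj⁻      : ∀ {a b} → old a ~[ F ] old b → a ~[ G ] b
    u~w₁          : old u ~[ F ] w₁
    w₁~w₂         : w₁ ~[ F ] w₂
    w₂~w₃         : w₂ ~[ F ] w₃
    w₃~w₄         : w₃ ~[ F ] w₄
    w₄~v          : w₄ ~[ F ] old v
    ~w₁⇒u         : ∀ {a} → old a ~[ F ] w₁ → a ≡ u
    ~w₄⇒v         : ∀ {a} → old a ~[ F ] w₄ → a ≡ v
    old≁w₂        : ∀ {a} → ¬ (old a ~[ F ] w₂)
    old≁w₃        : ∀ {a} → ¬ (old a ~[ F ] w₃)
    w₁≁w₃         : ¬ (w₁ ~[ F ] w₃)
    w₂≁w₄         : ¬ (w₂ ~[ F ] w₄)
    elim          : (P : Fin m → Set) → (∀ a → P (old a)) →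
                    P w₁ → P w₂ → P w₃ → P w₄ → ∀ x → P x

reverse : ∀ {n m} {G : Graph n} {F : Graph m} → Subdivision G F → Subdivision G F
reverse {G = G} {F} 𝒮 = record
  { u = v ; v = u ; u~v = ~-sym G u~v ; old = old
  ; w₁ = w₄ ; w₂ = w₃ ; w₃ = w₂ ; w₄ = w₁
  ; old-injective = old-injective
  ; old-adj = λ a~b ¬vu ¬uv → old-adj a~b ¬uv ¬vu
  ; old-adj⁻ = old-adj⁻
  ; u~w₁ = ~-sym F w₄~v ; w₁~w₂ = ~-sym F w₃~w₄ ; w₂~w₃ = ~-sym F w₂~w₃
  ; w₃~w₄ = ~-sym F w₁~w₂ ; w₄~v = ~-sym F u~w₁
  ; ~w₁⇒u = ~w₄⇒v ; ~w₄⇒v = ~w₁⇒u ; old≁w₂ = old≁w₃ ; old≁w₃ = old≁w₂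
  ; w₁≁w₃ = w₂≁w₄ ∘ ~-sym F ; w₂≁w₄ = w₁≁w₃ ∘ ~-sym F
  ; elim = λ P p-old p₁ p₂ p₃ p₄ → elim P p-old p₄ p₃ p₂ p₁
  }
  where open Subdivision 𝒮

module SubdivisionProperties {n m} {G : Graph n} {F : Graph m} (𝒮 : Subdivision G F) where
  open Subdivision 𝒮

  v~w₄ : old v ~[ F ] w₄
  v~w₄ = ~-sym F w₄~v

  w₁~u : w₁ ~[ F ] old u
  w₁~u = ~-sym F u~w₁

  w₂~w₁ : w₂ ~[ F ] w₁
  w₂~w₁ = ~-sym F w₁~w₂

  w₃~w₂ : w₃ ~[ F ] w₂
  w₃~w₂ = ~-sym F w₂~w₃

  w₄~w₃ : w₄ ~[ F ] w₃
  w₄~w₃ = ~-sym F w₃~w₄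

  u≢v : u ≢ v
  u≢v = ~⇒≢ G u~v

  old≢w₁ : ∀ {a} → old a ≢ w₁
  old≢w₁ refl = old≁w₂ w₁~w₂

  old≢w₂ : ∀ {a} → old a ≢ w₂
  old≢w₂ refl = old≁w₃ w₂~w₃

  old≢w₄ : ∀ {a} → old a ≢ w₄
  old≢w₄ refl = old≁w₃ w₄~w₃

  w₂≢w₄ : w₂ ≢ w₄
  w₂≢w₄ w₂≡w₄ = old≁w₂ (subst (old v ~[ F ]_) (sym w₂≡w₄) v~w₄)

  old-adj-away : ∀ {a b} → a ≢ u → a ≢ v → a ~[ G ] b → old a ~[ F ] old b
  old-adj-away a≢u a≢v a~b = old-adj a~b (a≢u ∘ proj₁) (a≢v ∘ proj₁)

  dist2-old : ∀ {x c s} → x ≢ s → ¬ (x ~[ G ] s) →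
              old x ~[ F ] old c → old c ~[ F ] old s → Dist2 F (old x) (old s)
  dist2-old x≢s x≁s x~c c~s = x≢s ∘ old-injective , x≁s ∘ old-adj⁻ , _ , x~c , c~s

  dist2-u-w₂ : Dist2 F (old u) w₂
  dist2-u-w₂ = old≢w₂ , old≁w₂ , w₁ , u~w₁ , w₁~w₂

  dist2-w₂-w₄ : Dist2 F w₂ w₄
  dist2-w₂-w₄ = w₂≢w₄ , w₂≁w₄ , w₃ , w₂~w₃ , w₃~w₄

  dist2-w₄ : ∀ {t} → old v ~[ F ] old t → t ≢ v → Dist2 F w₄ (old t)
  dist2-w₄ v~t t≢v = old≢w₄ ∘ sym , t≢v ∘ ~w₄⇒v ∘ ~-sym F , old v , w₄~v , v~t

  dist2-w₁ : ∀ {x} → x ≢ u → x ≢ v → x ~[ G ] u → Dist2 F (old x) w₁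
  dist2-w₁ x≢u x≢v x~u = old≢w₁ , x≢u ∘ ~w₁⇒u , old u , old-adj-away x≢u x≢v x~u , u~w₁

  -- The witness s is lost exactly when the middle vertex of its path from u was v.
  lift-from-u : ∀ {s} → Dist2 G u s → Dist2 F (old u) (old s) ⊎ old v ~[ F ] old s
  lift-from-u (u≢s , u≁s , c , u~c , c~s) with c ≟ v
  ... | yes refl = inj₂ (old-adj c~s (u≢v ∘ sym ∘ proj₁) (u≢s ∘ sym ∘ proj₂))
  ... | no c≢v = inj₁ (dist2-old u≢s u≁s
          (old-adj u~c (c≢v ∘ proj₂) (u≢v ∘ proj₁))
          (old-adj c~s (λ (c≡u , _) → ~⇒≢ G u~c (sym c≡u)) (c≢v ∘ proj₁)))

  Broken : Fin n → Fin n → Set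
  Broken x s = (x ~[ G ] u × s ≡ v) ⊎ (x ~[ G ] v × s ≡ u)

  lift-away : ∀ {x s} → x ≢ u → x ≢ v → Dist2 G x s → Dist2 F (old x) (old s) ⊎ Broken x s
  lift-away {s = s} x≢u x≢v (x≢s , x≁s , c , x~c , c~s) with (c ≟ u) ×-dec (s ≟ v)
  ... | yes (refl , refl) = inj₂ (inj₁ (x~c , refl))
  ... | no ¬uv with (c ≟ v) ×-dec (s ≟ u)
  ...   | yes (refl , refl) = inj₂ (inj₂ (x~c , refl))
  ...   | no ¬vu = inj₁ (dist2-old x≢s x≁s (old-adj-away x≢u x≢v x~c) (old-adj c~s ¬uv ¬vu))

  isDTD-intro : ∀ {T} → (∀ {x} → x ≢ u → x ≢ v → Dominated F T (old x)) →
                Dominated F T (old u) → Dominated F T (old v) →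
                Dominated F T w₁ → Dominated F T w₂ → Dominated F T w₃ → Dominated F T w₄ →
                IsDTD F T
  isDTD-intro {T} d-away d-u d-v = elim (Dominated F T) d-old
    where
    d-old : ∀ a → Dominated F T (old a)
    d-old a with a ≟ u | a ≟ v
    ... | yes refl | _ = d-u
    ... | no _ | yes refl = d-v
    ... | no a≢u | no a≢v = d-away a≢u a≢v

module Extension {n m} {G : Graph n} {F : Graph m} (𝒮 : Subdivision G F)
                 (S : Subset n) (S-dtd : IsDTD G S) where
  open Subdivision 𝒮
  open SubdivisionProperties 𝒮
  open Domination F
  -- The same facts with the path read from v to u: Mirror's u, w₁, w₂ are our v, w₄, w₃.
  private module Mirror = SubdivisionProperties (reverse 𝒮)

  Covers : Subset m → Set
  Covers T = ∀ {a} → a ∈ S → old a ∈ T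

  Intact : Set
  Intact = ∀ {T} → Covers T → Dominated F T (old u)

  -- When v ∉ S, each witness of u at distance 2 either survives in F or becomes a
  -- neighbour of v (lift-from-u); Survival records how many of them survive.
  data Survival : Set where
    intact    : Intact → Survival
    half-lost : ∀ {s t} → s ∈ S → Dist2 F (old u) (old s) →
                t ∈ S → old v ~[ F ] old t → Survival
    lost      : ∀ {s₁ s₂} → s₁ ≢ s₂ → s₁ ∈ S → s₂ ∈ S →
                old v ~[ F ] old s₁ → old v ~[ F ] old s₂ → Survival

  survival : ¬ (v ∈ S) → Survival
  survival v∉S with S-dtd u
  ... | inj₁ (s , s∈S , u~s) = intact λ cov →
          by-neighbour (cov s∈S) (old-adj u~s (∈∧∉⇒≢ s∈S v∉S ∘ proj₂) (u≢v ∘ proj₁))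
  ... | inj₂ (s₁ , s₂ , s₁≢s₂ , s₁∈S , s₂∈S , d₁ , d₂) with lift-from-u d₁ | lift-from-u d₂
  ...   | inj₁ e₁ | inj₁ e₂ = intact λ cov →
            by-pair (s₁≢s₂ ∘ old-injective) (cov s₁∈S) (cov s₂∈S) e₁ e₂
  ...   | inj₁ e₁ | inj₂ c₂ = half-lost s₁∈S e₁ s₂∈S c₂
  ...   | inj₂ c₁ | inj₁ e₂ = half-lost s₂∈S e₂ s₁∈S c₁
  ...   | inj₂ c₁ | inj₂ c₂ = lost s₁≢s₂ s₁∈S s₂∈S c₁ c₂

  intact-or-cut : Survival → Intact ⊎ ∃[ t ] (t ∈ S × old v ~[ F ] old t)
  intact-or-cut (intact du) = inj₁ du
  intact-or-cut (half-lost _ _ t∈S v~t) = inj₂ (_ , t∈S , v~t)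
  intact-or-cut (lost _ t∈S _ v~t _) = inj₂ (_ , t∈S , v~t)

  module _ {T} (cov : Covers T) where

    module _ (v-rescued : v ∈ S → u ∈ S ⊎ w₁ ∈ T) (u-rescued : u ∈ S → v ∈ S ⊎ w₄ ∈ T)
             {x} (x≢u : x ≢ u) (x≢v : x ≢ v) where

      rescue : ∀ {s t} → Broken x s → s ∈ S → t ∈ S → Dist2 F (old x) (old t) →
               Dominated F T (old x)
      rescue (inj₁ (x~u , refl)) v∈S t∈S e with v-rescued v∈S
      ... | inj₁ u∈S = by-neighbour (cov u∈S) (old-adj-away x≢u x≢v x~u)
      ... | inj₂ w₁∈T = by-pair (old≢w₁ ∘ sym) w₁∈T (cov t∈S) (dist2-w₁ x≢u x≢v x~u) e
      rescue (inj₂ (x~v , refl)) u∈S t∈S e with u-rescued u∈S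
      ... | inj₁ v∈S = by-neighbour (cov v∈S) (old-adj-away x≢u x≢v x~v)
      ... | inj₂ w₄∈T = by-pair (old≢w₄ ∘ sym) w₄∈T (cov t∈S) (Mirror.dist2-w₁ x≢v x≢u x~v) e

      -- Two distinct broken witnesses are v (reached via u) and u itself.
      both-broken : ∀ {s₁ s₂} → s₁ ≢ s₂ → s₁ ∈ S → s₂ ∈ S → Broken x s₁ → Broken x s₂ →
                    Dominated F T (old x)
      both-broken _ _ u∈S (inj₁ (x~u , _)) (inj₂ (_ , refl)) =
        by-neighbour (cov u∈S) (old-adj-away x≢u x≢v x~u)
      both-broken _ u∈S _ (inj₂ (_ , refl)) (inj₁ (x~u , _)) =
        by-neighbour (cov u∈S) (old-adj-away x≢u x≢v x~u)
      both-broken s₁≢s₂ _ _ (inj₁ (_ , refl)) (inj₁ (_ , refl)) = ⊥-elim (s₁≢s₂ refl)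
      both-broken s₁≢s₂ _ _ (inj₂ (_ , refl)) (inj₂ (_ , refl)) = ⊥-elim (s₁≢s₂ refl)

      old-dominated : Dominated F T (old x)
      old-dominated with S-dtd x
      ... | inj₁ (s , s∈S , x~s) = by-neighbour (cov s∈S) (old-adj-away x≢u x≢v x~s)
      ... | inj₂ (s₁ , s₂ , s₁≢s₂ , s₁∈S , s₂∈S , d₁ , d₂)
          with lift-away x≢u x≢v d₁ | lift-away x≢u x≢v d₂
      ...   | inj₁ e₁ | inj₁ e₂ = by-pair (s₁≢s₂ ∘ old-injective) (cov s₁∈S) (cov s₂∈S) e₁ e₂
      ...   | inj₂ b₁ | inj₁ e₂ = rescue b₁ s₁∈S s₂∈S e₂
      ...   | inj₁ e₁ | inj₂ b₂ = rescue b₂ s₂∈S s₁∈S e₁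
      ...   | inj₂ b₁ | inj₂ b₂ = both-broken s₁≢s₂ s₁∈S s₂∈S b₁ b₂

    isDTD-∈∈ : u ∈ S → v ∈ S → w₁ ∈ T → w₄ ∈ T → IsDTD F T
    isDTD-∈∈ u∈S v∈S w₁∈T w₄∈T = isDTD-intro
      (old-dominated (λ _ → inj₁ u∈S) (λ _ → inj₁ v∈S))
      (by-neighbour w₁∈T u~w₁)
      (by-neighbour w₄∈T v~w₄)
      (by-neighbour (cov u∈S) w₁~u)
      (by-neighbour w₁∈T w₂~w₁)
      (by-neighbour w₄∈T w₃~w₄)
      (by-neighbour (cov v∈S) w₄~v)

    module _ (u∈S : u ∈ S) (v∉S : ¬ (v ∈ S)) where

      isDTD-∈∉-intact : Dominated F T (old u) → w₃ ∈ T → w₄ ∈ T → IsDTD F T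
      isDTD-∈∉-intact du w₃∈T w₄∈T = isDTD-intro
        (old-dominated (⊥-elim ∘ v∉S) (λ _ → inj₂ w₄∈T))
        du
        (by-neighbour w₄∈T v~w₄)
        (by-neighbour (cov u∈S) w₁~u)
        (by-neighbour w₃∈T w₂~w₃)
        (by-neighbour w₄∈T w₃~w₄)
        (by-neighbour w₃∈T w₄~w₃)

      isDTD-∈∉-half-lost : ∀ {s t} → s ∈ S → Dist2 F (old u) (old s) →
                           t ∈ S → old v ~[ F ] old t → w₂ ∈ T → w₄ ∈ T → IsDTD F T
      isDTD-∈∉-half-lost s∈S u-s t∈S v~t w₂∈T w₄∈T = isDTD-intro
        (old-dominated (⊥-elim ∘ v∉S) (λ _ → inj₂ w₄∈T))
        (by-pair (old≢w₂ ∘ sym) w₂∈T (cov s∈S) dist2-u-w₂ u-s)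
        (by-neighbour w₄∈T v~w₄)
        (by-neighbour (cov u∈S) w₁~u)
        (by-pair old≢w₄ (cov u∈S) w₄∈T (dist2-sym F dist2-u-w₂) dist2-w₂-w₄)
        (by-neighbour w₂∈T w₃~w₂)
        (by-pair (old≢w₂ ∘ sym) w₂∈T (cov t∈S)
          (dist2-sym F dist2-w₂-w₄) (dist2-w₄ v~t (∈∧∉⇒≢ t∈S v∉S)))

      isDTD-∈∉-lost : ∀ {s₁ s₂} → s₁ ≢ s₂ → s₁ ∈ S → s₂ ∈ S →
                      old v ~[ F ] old s₁ → old v ~[ F ] old s₂ → w₁ ∈ T → w₄ ∈ T → IsDTD F T
      isDTD-∈∉-lost s₁≢s₂ s₁∈S s₂∈S v~s₁ v~s₂ w₁∈T w₄∈T = isDTD-intro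
        (old-dominated (⊥-elim ∘ v∉S) (λ _ → inj₂ w₄∈T))
        (by-neighbour w₁∈T u~w₁)
        (by-neighbour w₄∈T v~w₄)
        (by-neighbour (cov u∈S) w₁~u)
        (by-neighbour w₁∈T w₂~w₁)
        (by-neighbour w₄∈T w₃~w₄)
        (by-pair (s₁≢s₂ ∘ old-injective) (cov s₁∈S) (cov s₂∈S)
          (dist2-w₄ v~s₁ (∈∧∉⇒≢ s₁∈S v∉S)) (dist2-w₄ v~s₂ (∈∧∉⇒≢ s₂∈S v∉S)))

    module _ (u∉S : ¬ (u ∈ S)) (v∉S : ¬ (v ∈ S)) where

      isDTD-∉∉-cut : ∀ {t} → t ∈ S → old v ~[ F ] old t → w₁ ∈ T → w₂ ∈ T → IsDTD F T
      isDTD-∉∉-cut t∈S v~t w₁∈T w₂∈T = isDTD-intro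
        (old-dominated (⊥-elim ∘ v∉S) (⊥-elim ∘ u∉S))
        (by-neighbour w₁∈T u~w₁)
        (by-neighbour (cov t∈S) v~t)
        (by-neighbour w₂∈T w₁~w₂)
        (by-neighbour w₁∈T w₂~w₁)
        (by-neighbour w₂∈T w₃~w₂)
        (by-pair (old≢w₂ ∘ sym) w₂∈T (cov t∈S)
          (dist2-sym F dist2-w₂-w₄) (dist2-w₄ v~t (∈∧∉⇒≢ t∈S v∉S)))

      isDTD-∉∉-intact : Dominated F T (old u) → Dominated F T (old v) →
                        w₂ ∈ T → w₃ ∈ T → IsDTD F T
      isDTD-∉∉-intact du dv w₂∈T w₃∈T = isDTD-intro
        (old-dominated (⊥-elim ∘ v∉S) (⊥-elim ∘ u∉S))
        du
        dv
        (by-neighbour w₂∈T w₁~w₂)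
        (by-neighbour w₃∈T w₂~w₃)
        (by-neighbour w₂∈T w₃~w₂)
        (by-neighbour w₃∈T w₄~w₃)

  -- S together with y and z dominates F, whatever subset of Fin m represents that union.
  Extendable : Set
  Extendable = ∃₂ λ y z → ∀ {T} → Covers T → y ∈ T → z ∈ T → IsDTD F T

  extendable-∈∈ : u ∈ S → v ∈ S → Extendable
  extendable-∈∈ u∈S v∈S = w₁ , w₄ , λ cov → isDTD-∈∈ cov u∈S v∈S

  extendable-∈∉ : u ∈ S → ¬ (v ∈ S) → Extendable
  extendable-∈∉ u∈S v∉S with survival v∉S
  ... | intact du = w₃ , w₄ , λ cov → isDTD-∈∉-intact cov u∈S v∉S (du cov)
  ... | half-lost s∈S u-s t∈S v~t =
          w₂ , w₄ , λ cov → isDTD-∈∉-half-lost cov u∈S v∉S s∈S u-s t∈S v~t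
  ... | lost s₁≢s₂ s₁∈S s₂∈S v~s₁ v~s₂ =
          w₁ , w₄ , λ cov → isDTD-∈∉-lost cov u∈S v∉S s₁≢s₂ s₁∈S s₂∈S v~s₁ v~s₂

  extendable-∉∉-cut : ¬ (u ∈ S) → ¬ (v ∈ S) → ∀ {t} → t ∈ S → old v ~[ F ] old t → Extendable
  extendable-∉∉-cut u∉S v∉S t∈S v~t = w₁ , w₂ , λ cov → isDTD-∉∉-cut cov u∉S v∉S t∈S v~t

  extendable-∉∉-intact : ¬ (u ∈ S) → ¬ (v ∈ S) →
                         Intact → (∀ {T} → Covers T → Dominated F T (old v)) → Extendable
  extendable-∉∉-intact u∉S v∉S du dv =
    w₂ , w₃ , λ cov → isDTD-∉∉-intact cov u∉S v∉S (du cov) (dv cov)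

module _ {n m} {G : Graph n} {F : Graph m} (𝒮 : Subdivision G F)
         {S : Subset n} (S-dtd : IsDTD G S) where
  open Subdivision 𝒮
  private
    module E = Extension 𝒮 S S-dtd
    module R = Extension (reverse 𝒮) S S-dtd

  extendable : E.Extendable
  extendable with u ∈? S | v ∈? S
  ... | yes u∈S | yes v∈S = E.extendable-∈∈ u∈S v∈S
  ... | yes u∈S | no v∉S = E.extendable-∈∉ u∈S v∉S
  ... | no u∉S | yes v∈S = R.extendable-∈∉ v∈S u∉S
  ... | no u∉S | no v∉S with E.intact-or-cut (E.survival v∉S) | R.intact-or-cut (R.survival u∉S)
  ...   | inj₂ (_ , t∈S , v~t) | _ = E.extendable-∉∉-cut u∉S v∉S t∈S v~t
  ...   | inj₁ _ | inj₂ (_ , t∈S , u~t) = R.extendable-∉∉-cut v∉S u∉S t∈S u~t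
  ...   | inj₁ du | inj₁ dv = E.extendable-∉∉-intact u∉S v∉S du dv

eqB-refl : ∀ {m} (a : Fin m) → eqB a a ≡ true
eqB-refl a with a ≟ a
... | yes _ = refl
... | no a≢a = ⊥-elim (a≢a refl)

eqB-sound : ∀ {m} {a b : Fin m} → eqB a b ≡ true → a ≡ b
eqB-sound {a = a} {b} eq with a ≟ b
... | yes a≡b = a≡b

eqB-∧-false : ∀ {m} {a b c d : Fin m} → ¬ (a ≡ c × b ≡ d) → eqB a c ∧ eqB b d ≡ false
eqB-∧-false {a = a} {b} {c} {d} ¬eq with a ≟ c | b ≟ d
... | yes a≡c | yes b≡d = ⊥-elim (¬eq (a≡c , b≡d))
... | yes _ | no _ = refl
... | no _ | _ = refl

attach-0F : ∀ {n} (u v a : Fin n) → attach u v a 0F ≡ eqB a u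
attach-0F u v a = trans (cong₂ _∨_ (∧-identityʳ (eqB a u)) (∧-zeroʳ (eqB a v))) (∨-identityʳ (eqB a u))

attach-3F : ∀ {n} (u v a : Fin n) → attach u v a 3F ≡ eqB a v
attach-3F u v a = trans (cong (_∨ (eqB a v ∧ true)) (∧-zeroʳ (eqB a u))) (∧-identityʳ (eqB a v))

attach-inner : ∀ {n} (u v a : Fin n) (i : Fin 4) →
               eqB i 0F ≡ false → eqB i 3F ≡ false → attach u v a i ≡ false
attach-inner u v a i i≢0 i≢3 rewrite i≢0 | i≢3 = cong₂ _∨_ (∧-zeroʳ (eqB a u)) (∧-zeroʳ (eqB a v))

isEdgeUV-false : ∀ {n} {u v a b : Fin n} → ¬ (a ≡ u × b ≡ v) → ¬ (a ≡ v × b ≡ u) →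
                 isEdgeUV u v a b ≡ false
isEdgeUV-false ¬uv ¬vu = cong₂ _∨_ (eqB-∧-false ¬uv) (eqB-∧-false ¬vu)

module _ {n} (G : Graph n) {u v : Fin n} (u~v : u ~[ G ] v) {F : Graph (n + 4)}
         (F-is : Is4SubdivisionAt G u v F) where

  private
    adj-join : ∀ p q → Adj F (join n 4 p) (join n 4 q) ≡ subAdj⊎ G u v p q
    adj-join p q = trans (F-is _ _) (cong₂ (subAdj⊎ G u v) (splitAt-join n 4 p) (splitAt-join n 4 q))

    adj⁺ : ∀ p q → subAdj⊎ G u v p q ≡ true → Adj F (join n 4 p) (join n 4 q) ≡ true
    adj⁺ p q = trans (adj-join p q)

    adj⁻ : ∀ p q → Adj F (join n 4 p) (join n 4 q) ≡ true → subAdj⊎ G u v p q ≡ true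
    adj⁻ p q = trans (sym (adj-join p q))

    on-parts : (P : Fin (n + 4) → Set) → (∀ a → P (a ↑ˡ 4)) →
               P (n ↑ʳ 0F) → P (n ↑ʳ 1F) → P (n ↑ʳ 2F) → P (n ↑ʳ 3F) → ∀ p → P (join n 4 p)
    on-parts P p-old p₁ p₂ p₃ p₄ (inj₁ a) = p-old a
    on-parts P p-old p₁ p₂ p₃ p₄ (inj₂ 0F) = p₁
    on-parts P p-old p₁ p₂ p₃ p₄ (inj₂ 1F) = p₂
    on-parts P p-old p₁ p₂ p₃ p₄ (inj₂ 2F) = p₃
    on-parts P p-old p₁ p₂ p₃ p₄ (inj₂ 3F) = p₄

  subdivisionAt : Subdivision G F
  subdivisionAt = record
    { u = u ; v = v ; u~v = u~v
    ; old = _↑ˡ 4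
    ; w₁ = n ↑ʳ 0F ; w₂ = n ↑ʳ 1F ; w₃ = n ↑ʳ 2F ; w₄ = n ↑ʳ 3F
    ; old-injective = ↑ˡ-injective 4 _ _
    ; old-adj = λ {a} {b} a~b ¬uv ¬vu →
        adj⁺ (inj₁ a) (inj₁ b) (cong₂ (λ x y → x ∧ notB y) a~b (isEdgeUV-false ¬uv ¬vu))
    ; old-adj⁻ = λ {a} {b} h → ∧-conicalˡ _ _ (adj⁻ (inj₁ a) (inj₁ b) h)
    ; u~w₁ = adj⁺ (inj₁ u) (inj₂ 0F) (trans (attach-0F u v u) (eqB-refl u))
    ; w₁~w₂ = adj⁺ (inj₂ 0F) (inj₂ 1F) refl
    ; w₂~w₃ = adj⁺ (inj₂ 1F) (inj₂ 2F) refl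
    ; w₃~w₄ = adj⁺ (inj₂ 2F) (inj₂ 3F) refl
    ; w₄~v = adj⁺ (inj₂ 3F) (inj₁ v) (trans (attach-3F u v v) (eqB-refl v))
    ; ~w₁⇒u = λ {a} h → eqB-sound (trans (sym (attach-0F u v a)) (adj⁻ (inj₁ a) (inj₂ 0F) h))
    ; ~w₄⇒v = λ {a} h → eqB-sound (trans (sym (attach-3F u v a)) (adj⁻ (inj₁ a) (inj₂ 3F) h))
    ; old≁w₂ = λ {a} → not-¬ (attach-inner u v a 1F refl refl) ∘ adj⁻ (inj₁ a) (inj₂ 1F)
    ; old≁w₃ = λ {a} → not-¬ (attach-inner u v a 2F refl refl) ∘ adj⁻ (inj₁ a) (inj₂ 2F)
    ; w₁≁w₃ = λ h → case adj⁻ (inj₂ 0F) (inj₂ 2F) h of λ ()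
    ; w₂≁w₄ = λ h → case adj⁻ (inj₂ 1F) (inj₂ 3F) h of λ ()
    ; elim = λ P p-old p₁ p₂ p₃ p₄ x →
        subst P (join-splitAt n 4 x) (on-parts P p-old p₁ p₂ p₃ p₄ (splitAt n x))
    }

∣p∪q∣≤∣p∣+∣q∣ : ∀ {n} (p q : Subset n) → ∣ p ∪ q ∣ ≤ ∣ p ∣ + ∣ q ∣
∣p∪q∣≤∣p∣+∣q∣ [] [] = z≤n
∣p∪q∣≤∣p∣+∣q∣ (inside ∷ p) (x ∷ q) =
  s≤s (≤-trans (∣p∪q∣≤∣p∣+∣q∣ p q) (+-monoʳ-≤ ∣ p ∣ (∣p∣≤∣x∷p∣ x q)))
∣p∪q∣≤∣p∣+∣q∣ (outside ∷ p) (outside ∷ q) = ∣p∪q∣≤∣p∣+∣q∣ p q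
∣p∪q∣≤∣p∣+∣q∣ (outside ∷ p) (inside ∷ q) =
  ≤-trans (s≤s (∣p∪q∣≤∣p∣+∣q∣ p q)) (≤-reflexive (sym (+-suc ∣ p ∣ ∣ q ∣)))

∣p++q∣≡∣p∣+∣q∣ : ∀ {m n} (p : Subset m) (q : Subset n) → ∣ p ++ q ∣ ≡ ∣ p ∣ + ∣ q ∣
∣p++q∣≡∣p∣+∣q∣ [] q = refl
∣p++q∣≡∣p∣+∣q∣ (inside ∷ p) q = cong suc (∣p++q∣≡∣p∣+∣q∣ p q)
∣p++q∣≡∣p∣+∣q∣ (outside ∷ p) q = ∣p++q∣≡∣p∣+∣q∣ p q

x∈p⇒x↑ˡ∈p++q : ∀ {m n} {p : Subset m} {x} (q : Subset n) → x ∈ p → (x ↑ˡ n) ∈ p ++ q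
x∈p⇒x↑ˡ∈p++q q here = here
x∈p⇒x↑ˡ∈p++q q (there x∈p) = there (x∈p⇒x↑ˡ∈p++q q x∈p)

∣p++⊥∪⁅y⁆∪⁅z⁆∣≤∣p∣+2 : ∀ {m n} (p : Subset m) (y z : Fin (m + n)) →
                       ∣ (p ++ ⊥) ∪ ⁅ y ⁆ ∪ ⁅ z ⁆ ∣ ≤ ∣ p ∣ + 2
∣p++⊥∪⁅y⁆∪⁅z⁆∣≤∣p∣+2 {n = n} p y z = begin
  ∣ (p ++ ⊥) ∪ ⁅ y ⁆ ∪ ⁅ z ⁆ ∣      ≤⟨ ∣p∪q∣≤∣p∣+∣q∣ (p ++ ⊥) _ ⟩
  ∣ p ++ ⊥ ∣ + ∣ ⁅ y ⁆ ∪ ⁅ z ⁆ ∣    ≤⟨ +-mono-≤ (≤-reflexive ∣p++⊥∣≡∣p∣) (∣p∪q∣≤∣p∣+∣q∣ ⁅ y ⁆ ⁅ z ⁆) ⟩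
  ∣ p ∣ + (∣ ⁅ y ⁆ ∣ + ∣ ⁅ z ⁆ ∣)   ≡⟨ cong (∣ p ∣ +_) (cong₂ _+_ (∣⁅x⁆∣≡1 y) (∣⁅x⁆∣≡1 z)) ⟩
  ∣ p ∣ + 2                          ∎
  where
  open ≤-Reasoning
  ∣p++⊥∣≡∣p∣ : ∣ p ++ ⊥ {n = n} ∣ ≡ ∣ p ∣
  ∣p++⊥∣≡∣p∣ = trans (∣p++q∣≡∣p∣+∣q∣ p ⊥) (trans (cong (∣ p ∣ +_) (∣⊥∣≡0 n)) (+-identityʳ ∣ p ∣))

subdivision-dtd : ∀ {n} (G : Graph n) {u v : Fin n} {F : Graph (n + 4)} →
                  u ~[ G ] v → Is4SubdivisionAt G u v F →
                  ∀ {S} → IsDTD G S → ∃[ T ] (IsDTD F T × ∣ T ∣ ≤ ∣ S ∣ + 2)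
subdivision-dtd G {F = F} u~v F-is {S} S-dtd with extendable (subdivisionAt G u~v {F} F-is) S-dtd
... | y , z , extends =
  (S ++ ⊥) ∪ ⁅ y ⁆ ∪ ⁅ z ⁆ ,
  extends (x∈p∪q⁺ ∘ inj₁ ∘ x∈p⇒x↑ˡ∈p++q ⊥)
          (x∈p∪q⁺ (inj₂ (x∈p∪q⁺ (inj₁ (x∈⁅x⁆ y)))))
          (x∈p∪q⁺ (inj₂ (x∈p∪q⁺ (inj₂ (x∈⁅x⁆ z))))) ,
  ∣p++⊥∪⁅y⁆∪⁅z⁆∣≤∣p∣+2 S y z

mainTheorem7 : ∀ {n} (G : Graph n) (u v : Fin n) (F : Graph (n + 4)) →
    NoIsolated G → u ~[ G ] v → Is4SubdivisionAt G u v F →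
    ∀ (k k′ : ℕ) → IsGammaTD G k → IsGammaTD F k′ → k′ ≤ k + 2
mainTheorem7 G u v F _ u~v F-is k k′ ((S , S-dtd , refl) , _) (_ , F-minimal)
  with subdivision-dtd G {F = F} u~v F-is S-dtd
... | T , T-dtd , ∣T∣≤ = ≤-trans (F-minimal T T-dtd) ∣T∣≤
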